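{- Let $G=(V,E)$ be a simple graph on $n$ vertices and $C\subseteq V$ such that no vertex of $V\setminus C$ is isolated in $G$. Let $t\le k$ be positive integers and let $S=(v_1,\ldots,v_t)$ and $S'=(v_1,\ldots,v_t,v_{t+1},\ldots,v_k)$ be legal sequences of $G;C$. Then $$k\le n-\Bigl|\bigcup_{i=1}^t N\langle v_i\rangle\Bigr|+t.$$
   Context: For $v\in V$, $N(v)$ is the open neighborhood and $N[v]=N(v)\cup\{v\}$. Define $N\langle v\rangle=N[v]$ if $v\in C$ and $N\langle v\rangle=N(v)$ if $v\notin C$. A sequence $(v_1,\ldots,v_k)$ of distinct vertices is a legal sequence of $G;C$ if $N\langle v_i\rangle\setminus\bigcup_{j=1}^{i-1}N\langle v_j\rangle\neq\emptyset$ for all $i=2,\ldots,k$. -}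

module Defs where

open import Data.Nat using (ℕ)
open import Data.Bool using (Bool; true; false; if_then_else_)
open import Data.Fin using (Fin)
open import Data.Fin.Subset using (Subset; ⋃; _∪_; _∈_; _∉_; ⊥; Nonempty; ∁; _∩_)
open import Data.Vec using (tabulate; lookup)
open import Data.List using (List; []; _∷_; take; length)
open import Data.List.Relation.Unary.Unique.Propositional using (Unique)
open import Data.Product using (_×_; ∃-syntax)
open import Relation.Binary.PropositionalEquality using (_≡_)
open import Relation.Nullary using (¬_)

record SimpleGraph (n : ℕ) : Set where
  field
    adj      : Fin n → Fin n → Bool
    adj-sym  : ∀ u v → adj u v ≡ adj v u
    adj-irr  : ∀ v → adj v v ≡ false
open SimpleGraph public

N : ∀ {n} → SimpleGraph n → Fin n → Subset n
N G v = tabulate (λ u → adj G v u)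

N[_] : ∀ {n} → SimpleGraph n → Fin n → Subset n
N[ G ] v = tabulate (λ u → adj G v u) ∪ tabulate (λ u → lookup-eq u)
  where
  open import Data.Fin using (_≟_)
  open import Relation.Nullary.Decidable using (⌊_⌋)
  lookup-eq : Fin _ → Bool
  lookup-eq u = ⌊ u ≟ v ⌋

N⟨_,_⟩ : ∀ {n} → SimpleGraph n → Subset n → Fin n → Subset n
N⟨ G , C ⟩ v = if lookup C v then N[ G ] v else N G v

⋃N⟨_,_⟩ : ∀ {n} → SimpleGraph n → Subset n → List (Fin n) → Subset n
⋃N⟨ G , C ⟩ []       = ⊥
⋃N⟨ G , C ⟩ (v ∷ vs) = N⟨ G , C ⟩ v ∪ ⋃N⟨ G , C ⟩ vs

Isolated : ∀ {n} → SimpleGraph n → Fin n → Set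
Isolated G v = ∀ u → adj G v u ≡ false

-- Legal sequence of G;C: distinct vertices, and for every i ≥ 2 (1-based),
-- N⟨v_i⟩ minus the union of N⟨v_j⟩, j < i, is nonempty.
-- Here the condition is imposed for every position i with i ≥ 1 (0-based).
Legal : ∀ {n} → SimpleGraph n → Subset n → List (Fin n) → Set
Legal {n} G C vs =
  Unique vs ×
  (∀ (i : Fin (length vs)) → ¬ (Data.Fin.toℕ i ≡ 0) →
     ∃[ u ] (u ∈ N⟨ G , C ⟩ (Data.List.lookup vs i) ×
             u ∉ ⋃N⟨ G , C ⟩ (take (Data.Fin.toℕ i) vs)))
  where import Data.Fin

-- Every vertex appended after position t contributes a vertex outside the union of the
-- neighbourhoods N⟨v⟩ of its predecessors, so each of the k − t appended vertices strictly
-- enlarges that union.  Starting from ∣⋃ᵢ≤t N⟨vᵢ⟩∣ and never exceeding n, the union can be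
-- enlarged at most n − ∣⋃ᵢ≤t N⟨vᵢ⟩∣ times.
module Submission where

open import Defs
open import Data.Nat using (ℕ; _≤_; _+_; _∸_; suc)
open import Data.Nat.Properties
  using (≤-trans; ≤-reflexive; <⇒≢; m≤m+n; +-comm; +-suc; +-monoʳ-≤; +-monoˡ-≤; m+n≤o⇒m≤o∸n; module ≤-Reasoning)
open import Data.Fin using (Fin; toℕ)
open import Data.Fin.Subset using (Subset; _∈_; _∉_; ∣_∣; _⊂_; _∪_; ⊥)
open import Data.Fin.Subset.Properties
  using (∣p∣≤n; p⊂q⇒∣p∣<∣q∣; p⊆p∪q; q⊆p∪q; ∪-assoc; ∪-identityˡ)
open import Data.List using (List; []; _∷_; [_]; _++_; length; take; lookup)
open import Data.List.Properties using (length-++; ++-assoc)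
open import Data.Product using (_×_; _,_; ∃-syntax)
open import Data.Unit using (⊤; tt)
open import Relation.Nullary using (¬_)
open import Relation.Binary.PropositionalEquality
  using (_≡_; refl; sym; trans; cong; subst; subst₂; module ≡-Reasoning)

take-length-++ : ∀ {A : Set} (xs ys : List A) → take (length xs) (xs ++ ys) ≡ xs
take-length-++ []       ys = refl
take-length-++ (x ∷ xs) ys = cong (x ∷_) (take-length-++ xs ys)

lookup-++-length : ∀ {A : Set} (xs : List A) (y : A) (ys : List A) →
  ∃[ i ] (toℕ i ≡ length xs × lookup (xs ++ y ∷ ys) i ≡ y)
lookup-++-length []       y ys = Data.Fin.zero , refl , refl
lookup-++-length (x ∷ xs) y ys with lookup-++-length xs y ys
... | i , i≡ , lookup≡ = Data.Fin.suc i , cong suc i≡ , lookup≡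

module _ {n : ℕ} (G : SimpleGraph n) (C : Subset n) where

  ⋃N-++ : ∀ P Q → ⋃N⟨ G , C ⟩ (P ++ Q) ≡ ⋃N⟨ G , C ⟩ P ∪ ⋃N⟨ G , C ⟩ Q
  ⋃N-++ []      Q = sym (∪-identityˡ _)
  ⋃N-++ (v ∷ P) Q = begin
    N⟨ G , C ⟩ v ∪ ⋃N⟨ G , C ⟩ (P ++ Q)                       ≡⟨ cong (N⟨ G , C ⟩ v ∪_) (⋃N-++ P Q) ⟩
    N⟨ G , C ⟩ v ∪ (⋃N⟨ G , C ⟩ P ∪ ⋃N⟨ G , C ⟩ Q)             ≡⟨ sym (∪-assoc _ _ _) ⟩
    (N⟨ G , C ⟩ v ∪ ⋃N⟨ G , C ⟩ P) ∪ ⋃N⟨ G , C ⟩ Q             ∎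
    where open ≡-Reasoning

  Enlarges : List (Fin n) → Fin n → Set
  Enlarges P r = ∃[ u ] (u ∈ N⟨ G , C ⟩ r × u ∉ ⋃N⟨ G , C ⟩ P)

  ⋃N-⊂-∷ʳ : ∀ {P r} → Enlarges P r → ⋃N⟨ G , C ⟩ P ⊂ ⋃N⟨ G , C ⟩ (P ++ [ r ])
  ⋃N-⊂-∷ʳ {P} {r} (u , u∈N⟨r⟩ , u∉⋃N) rewrite ⋃N-++ P [ r ] =
    p⊆p∪q _ , u , q⊆p∪q _ _ (p⊆p∪q ⊥ u∈N⟨r⟩) , u∉⋃N

  EnlargingExtension : List (Fin n) → List (Fin n) → Set
  EnlargingExtension P []      = ⊤
  EnlargingExtension P (r ∷ R) = Enlarges P r × EnlargingExtension (P ++ [ r ]) R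

  length+∣⋃N∣≤n : ∀ P R → EnlargingExtension P R → length R + ∣ ⋃N⟨ G , C ⟩ P ∣ ≤ n
  length+∣⋃N∣≤n P []      tt        = ∣p∣≤n (⋃N⟨ G , C ⟩ P)
  length+∣⋃N∣≤n P (r ∷ R) (r⁺ , R⁺) = begin
    suc (length R) + ∣ ⋃N⟨ G , C ⟩ P ∣       ≡⟨ sym (+-suc (length R) _) ⟩
    length R + suc ∣ ⋃N⟨ G , C ⟩ P ∣         ≤⟨ +-monoʳ-≤ (length R) (p⊂q⇒∣p∣<∣q∣ (⋃N-⊂-∷ʳ {P} {r} r⁺)) ⟩
    length R + ∣ ⋃N⟨ G , C ⟩ (P ++ [ r ]) ∣  ≤⟨ length+∣⋃N∣≤n (P ++ [ r ]) R R⁺ ⟩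
    n                                        ∎
    where open ≤-Reasoning

  EnlargingFrom : ℕ → List (Fin n) → Set
  EnlargingFrom m L = ∀ (i : Fin (length L)) → m ≤ toℕ i → Enlarges (take (toℕ i) L) (lookup L i)

  EnlargingFrom-length⇒EnlargingExtension :
    ∀ P R → EnlargingFrom (length P) (P ++ R) → EnlargingExtension P R
  EnlargingFrom-length⇒EnlargingExtension P []      _ = tt
  EnlargingFrom-length⇒EnlargingExtension P (r ∷ R) h =
    r⁺ , EnlargingFrom-length⇒EnlargingExtension (P ++ [ r ]) R R⁺
    where
    r⁺ : Enlarges P r
    r⁺ with lookup-++-length P r R
    ... | i , i≡ , lookup≡ =
      subst₂ Enlarges
        (trans (cong (λ m → take m (P ++ r ∷ R)) i≡) (take-length-++ P (r ∷ R)))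
        lookup≡
        (h i (≤-reflexive (sym i≡)))

    R⁺ : EnlargingFrom (length (P ++ [ r ])) ((P ++ [ r ]) ++ R)
    R⁺ rewrite ++-assoc P [ r ] R | length-++ P {[ r ]} =
      λ i P+1≤i → h i (≤-trans (m≤m+n (length P) 1) P+1≤i)

  Legal⇒EnlargingFrom : ∀ {m L} → 1 ≤ m → Legal G C L → EnlargingFrom m L
  Legal⇒EnlargingFrom 1≤m (_ , legal) i m≤i = legal i λ i≡0 → <⇒≢ (≤-trans 1≤m m≤i) (sym i≡0)

proposition2 : ∀ {n : ℕ} (G : SimpleGraph n) (C : Subset n) →
    (∀ v → v ∉ C → ¬ Isolated G v) →
    (S R : List (Fin n)) →
    1 ≤ length S →
    Legal G C S → Legal G C (S ++ R) →
    length (S ++ R) ≤ (n ∸ ∣ ⋃N⟨ G , C ⟩ S ∣) + length S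
proposition2 {n} G C _ S R 1≤∣S∣ _ legal = begin
  length (S ++ R)                      ≡⟨ trans (length-++ S) (+-comm (length S) (length R)) ⟩
  length R + length S                  ≤⟨ +-monoˡ-≤ (length S) (m+n≤o⇒m≤o∸n (length R) counted) ⟩
  (n ∸ ∣ ⋃N⟨ G , C ⟩ S ∣) + length S   ∎
  where
  open ≤-Reasoning
  counted : length R + ∣ ⋃N⟨ G , C ⟩ S ∣ ≤ n
  counted = length+∣⋃N∣≤n G C S R
    (EnlargingFrom-length⇒EnlargingExtension G C S R (Legal⇒EnlargingFrom G C 1≤∣S∣ legal))
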